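{- Let $C$ be a complete lattice and let $b\colon C \to C$ be a monotone, Scott cocontinuous map (i.e., $b$ preserves greatest lower bounds of directed chains). Let $\Omega_b \subseteq C$ be the sublattice consisting of the chain \[\top \sqsupseteq b(\top)\sqsupseteq bb(\top) \sqsupseteq \dots \sqsupseteq \nu b,\] where $\nu b$ is the greatest fixed point of $b$ (which, by cocontinuity, is the greatest lower bound of all $b^i(\top)$, $i\in\mathbb{N}$). Let $\omega_b\colon C \to C$ be the up-closure operator associated to $\Omega_b$, i.e., the up-closure whose set of pre-fixed points $Pre(\omega_b)=\{x\in C \mid \omega_b(x)\sqsubseteq x\}$ is exactly $\Omega_b$ (concretely, $\omega_b(x)$ is the greatest lower bound of the elements of $\Omega_b$ that are above $x$). Then $\omega_b$ is the greatest $b$-compatible map, that is: (1) $\omega_b$ is $b$-compatible, and (2) if a monotone map $a\colon C\to C$ is $b$-compatible, then $a\sqsubseteq \omega_b$ (pointwise). Moreover, (3) for any up-closure $a\colon C\to C$, $a\sqsubseteq \omega_b$ if and only if $\Omega_b \subseteq Pre(a)$.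
   Context: All maps are monotone and ordered pointwise. A monotone map $a\colon C \to C$ is called compatible w.r.t. $b$ ($b$-compatible) if $a \circ b \sqsubseteq b \circ a$. An up-closure operator is a monotone map $a$ with $x\sqsubseteq a(x)$ and $a(a(x))\sqsubseteq a(x)$ for all $x$; $Pre(a)$ denotes its set of pre-fixed points $\{x \mid a(x)\sqsubseteq x\}$, which is a complete lattice, and up-closures are in bijection with such subsets. $\top$ denotes the top element of $C$. -}

module Defs where

open import Level using (Level; _⊔_; suc; Lift)
open import Data.Nat using (ℕ; zero) renaming (suc to sucℕ)
open import Data.Product using (Σ; ∃; _×_)
open import Data.Sum using (_⊎_)
open import Relation.Binary.Bundles using (Poset)
open import Relation.Binary.Definitions using (Monotonic₁)

record CompleteLattice (c ℓ₁ ℓ₂ : Level) : Set (suc (c ⊔ ℓ₁ ⊔ ℓ₂)) where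
  field
    poset : Poset c ℓ₁ ℓ₂
  open Poset poset public
  field
    ⊤       : Carrier
    ⊤-max   : ∀ x → x ≤ ⊤
    ⨅       : (Carrier → Set (c ⊔ ℓ₁ ⊔ ℓ₂)) → Carrier
    ⨅-lower : ∀ (S : Carrier → Set (c ⊔ ℓ₁ ⊔ ℓ₂)) x → S x → ⨅ S ≤ x
    ⨅-glb   : ∀ (S : Carrier → Set (c ⊔ ℓ₁ ⊔ ℓ₂)) z → (∀ x → S x → z ≤ x) → z ≤ ⨅ S

module _ {c ℓ₁ ℓ₂ : Level} (C : CompleteLattice c ℓ₁ ℓ₂) where
  open CompleteLattice C

  Pred : Set (suc (c ⊔ ℓ₁ ⊔ ℓ₂))
  Pred = Carrier → Set (c ⊔ ℓ₁ ⊔ ℓ₂)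

  Monotone : (Carrier → Carrier) → Set (c ⊔ ℓ₂)
  Monotone f = Monotonic₁ _≤_ _≤_ f

  Codirected : Pred → Set (c ⊔ ℓ₁ ⊔ ℓ₂)
  Codirected S = (∃ λ x → S x)
               × (∀ x y → S x → S y → ∃ λ z → S z × z ≤ x × z ≤ y)

  IsGlbOfImage : (Carrier → Carrier) → Pred → Carrier → Set (c ⊔ ℓ₁ ⊔ ℓ₂)
  IsGlbOfImage f S z = (∀ x → S x → z ≤ f x)
                     × (∀ w → (∀ x → S x → w ≤ f x) → w ≤ z)

  ScottCocontinuous : (Carrier → Carrier) → Set (suc (c ⊔ ℓ₁ ⊔ ℓ₂))
  ScottCocontinuous f = ∀ (S : Pred) → Codirected S → IsGlbOfImage f S (f (⨅ S))

  iter : ℕ → (Carrier → Carrier) → Carrier → Carrier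
  iter zero     f x = x
  iter (sucℕ n) f x = f (iter n f x)

  IsGreatestFixedPoint : (Carrier → Carrier) → Carrier → Set (c ⊔ ℓ₁ ⊔ ℓ₂)
  IsGreatestFixedPoint f x = (f x ≈ x) × (∀ y → f y ≈ y → y ≤ x)

  Ω : (Carrier → Carrier) → Pred
  Ω b x = (∃ λ (n : ℕ) → x ≈ iter n b ⊤) ⊎ IsGreatestFixedPoint b x

  ω : (Carrier → Carrier) → Carrier → Carrier
  ω b x = ⨅ (λ y → Ω b y × x ≤ y)

  Compatible : (Carrier → Carrier) → (Carrier → Carrier) → Set (c ⊔ ℓ₂)
  Compatible a b = ∀ x → a (b x) ≤ b (a x)

  _⊑ᶠ_ : (Carrier → Carrier) → (Carrier → Carrier) → Set (c ⊔ ℓ₂)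
  f ⊑ᶠ g = ∀ x → f x ≤ g x

  IsUpClosure : (Carrier → Carrier) → Set (c ⊔ ℓ₂)
  IsUpClosure a = Monotone a × (∀ x → x ≤ a x) × (∀ x → a (a x) ≤ a x)

  Pre : (Carrier → Carrier) → Pred
  Pre a x = Lift (c ⊔ ℓ₁ ⊔ ℓ₂) (a x ≤ x)

  _⊆_ : Pred → Pred → Set (c ⊔ ℓ₁ ⊔ ℓ₂)
  S ⊆ T = ∀ x → S x → T x

module Submission where

-- For a subset P of a complete lattice C write
--   closure P x = ⨅ { y ∈ P | x ≤ y },
-- so that ω_b is closure Ω_b.  Two facts about arbitrary P carry most of
-- the theorem: closure P is monotone, and a monotone map a lies below
-- closure P exactly when every point of P is a pre-fixed point of a.  This
-- gives part (3) directly (only monotonicity of the up-closure is used),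
-- and reduces part (2) to showing Ω_b ⊆ Pre(a) for b-compatible a: the
-- iterates bⁿ(⊤) are pre-fixed by induction on n, and the greatest fixed
-- point is handled through ν = ⨅ₙ bⁿ(⊤), which Scott cocontinuity makes a
-- fixed point.  For part (1) we use that Ω_b is a chain containing ⊤ and
-- closed under b; hence { y ∈ Ω_b | x ≤ y } is codirected, and cocontinuity
-- lets b commute with its meet, giving ω_b(b x) ≤ b(ω_b x).

open import Defs
open import Level using (Level; _⊔_; Lift; lift; lower)
open import Data.Product using (_×_; _,_; proj₁; proj₂; ∃)
open import Data.Sum using (_⊎_; inj₁; inj₂)
open import Function.Bundles using (_⇔_; mk⇔; Equivalence)
open import Data.Nat using (ℕ; zero; s≤s) renaming (suc to sucℕ; _≤_ to _≤ℕ_)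
open import Data.Nat.Properties using (≤-total)

module LatticeFacts {c ℓ₁ ℓ₂ : Level} (C : CompleteLattice c ℓ₁ ℓ₂) where
  open CompleteLattice C

  ≈⇒≥ : ∀ {x y} → x ≈ y → y ≤ x
  ≈⇒≥ e = reflexive (Eq.sym e)

  Above : Pred C → Carrier → Pred C
  Above P x y = P y × x ≤ y

  closure : Pred C → Carrier → Carrier
  closure P x = ⨅ (Above P x)

  closure-mono : ∀ P → Monotone C (closure P)
  closure-mono P {x} {x'} x≤x' =
    ⨅-glb (Above P x') _ λ y (Py , x'≤y) → ⨅-lower (Above P x) y (Py , trans x≤x' x'≤y)

  closure-pre : ∀ P y → P y → closure P y ≤ y
  closure-pre P y Py = ⨅-lower (Above P y) y (Py , refl)

  below-closure⇔ : ∀ P a → Monotone C a → (_⊑ᶠ_ C a (closure P) ⇔ _⊆_ C P (Pre C a))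
  below-closure⇔ P a a-mono = mk⇔
    (λ a≤cl y Py → lift (trans (a≤cl y) (closure-pre P y Py)))
    (λ P⊆Pre x → ⨅-glb (Above P x) (a x) λ y (Py , x≤y) → trans (a-mono x≤y) (lower (P⊆Pre y Py)))

  Chain : Pred C → Set (c ⊔ ℓ₁ ⊔ ℓ₂)
  Chain P = ∀ y z → P y → P z → (y ≤ z) ⊎ (z ≤ y)

  chain-codirected : ∀ P → Chain P → ∃ P → Codirected C P
  chain-codirected P chain inhabited = inhabited , common-lower-bound
    where
    common-lower-bound : ∀ y z → P y → P z → ∃ λ w → P w × w ≤ y × w ≤ z
    common-lower-bound y z Py Pz with chain y z Py Pz
    ... | inj₁ y≤z = y , Py , refl , y≤z
    ... | inj₂ z≤y = z , Pz , z≤y , refl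

  Above-chain : ∀ P x → Chain P → Chain (Above P x)
  Above-chain P x chain y z (Py , _) (Pz , _) = chain y z Py Pz

  module Iterates (b : Carrier → Carrier) (b-mono : Monotone C b) where

    it : ℕ → Carrier
    it n = iter C n b ⊤

    it-anti : ∀ {n m} → n ≤ℕ m → it m ≤ it n
    it-anti {zero}   {zero}   _       = refl
    it-anti {zero}   {sucℕ m} _       = ⊤-max _
    it-anti {sucℕ n} {sucℕ m} (s≤s p) = b-mono (it-anti p)

    fixed≤it : ∀ g → b g ≈ g → ∀ n → g ≤ it n
    fixed≤it g bg≈g zero     = ⊤-max g
    fixed≤it g bg≈g (sucℕ n) = trans (≈⇒≥ bg≈g) (b-mono (fixed≤it g bg≈g n))

    IsIterate : Pred C
    IsIterate y = Lift (c ⊔ ℓ₁ ⊔ ℓ₂) (∃ λ n → y ≈ it n)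

    iterates-chain : Chain IsIterate
    iterates-chain y z (lift (n , y≈)) (lift (m , z≈)) with ≤-total n m
    ... | inj₁ n≤m = inj₂ (trans (reflexive z≈) (trans (it-anti n≤m) (≈⇒≥ y≈)))
    ... | inj₂ m≤n = inj₁ (trans (reflexive y≈) (trans (it-anti m≤n) (≈⇒≥ z≈)))

    Ω-chain : Chain (Ω C b)
    Ω-chain y z (inj₁ (n , y≈)) (inj₁ (m , z≈)) =
      iterates-chain y z (lift (n , y≈)) (lift (m , z≈))
    Ω-chain y z (inj₁ (n , y≈)) (inj₂ (bz≈z , _)) = inj₂ (trans (fixed≤it z bz≈z n) (≈⇒≥ y≈))
    Ω-chain y z (inj₂ (by≈y , _)) (inj₁ (n , z≈)) = inj₁ (trans (fixed≤it y by≈y n) (≈⇒≥ z≈))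
    Ω-chain y z (inj₂ (by≈y , _)) (inj₂ (_ , z-greatest)) = inj₁ (z-greatest y by≈y)

    b-cong : ∀ {x y} → x ≈ y → b x ≈ b y
    b-cong x≈y = antisym (b-mono (reflexive x≈y)) (b-mono (≈⇒≥ x≈y))

    b-preserves-Ω : ∀ y → Ω C b y → Ω C b (b y)
    b-preserves-Ω y (inj₁ (n , y≈)) = inj₁ (sucℕ n , b-cong y≈)
    b-preserves-Ω y (inj₂ (by≈y , y-greatest)) =
      inj₂ (b-cong by≈y , λ z bz≈z → trans (y-greatest z bz≈z) (≈⇒≥ by≈y))

    Above-Ω-codirected : ∀ x → Codirected C (Above (Ω C b) x)
    Above-Ω-codirected x = chain-codirected (Above (Ω C b) x) (Above-chain (Ω C b) x Ω-chain)
                                            (⊤ , inj₁ (0 , Eq.refl) , ⊤-max x)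

    compatible-pre-it : ∀ a → Compatible C a b → ∀ n → a (it n) ≤ it n
    compatible-pre-it a a-compat zero     = ⊤-max _
    compatible-pre-it a a-compat (sucℕ n) =
      trans (a-compat (it n)) (b-mono (compatible-pre-it a a-compat n))

    module Cocontinuous (b-cocont : ScottCocontinuous C b) where

      iterates-codirected : Codirected C IsIterate
      iterates-codirected = chain-codirected IsIterate iterates-chain (⊤ , lift (0 , Eq.refl))

      ν : Carrier
      ν = ⨅ IsIterate

      ν≤it : ∀ n → ν ≤ it n
      ν≤it n = ⨅-lower IsIterate (it n) (lift (n , Eq.refl))

      -- ν is a fixed point: by cocontinuity b ν is the meet of the b-images
      -- of the iterates, i.e. of the iterates bⁿ(⊤) with n ≥ 1, and dropping
      -- ⊤ = b⁰(⊤) does not change the meet.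
      ν-fixed : b ν ≈ ν
      ν-fixed = antisym bν≤ν ν≤bν
        where
        b-image-glb : IsGlbOfImage C b IsIterate (b ν)
        b-image-glb = b-cocont IsIterate iterates-codirected

        bν≤ν : b ν ≤ ν
        bν≤ν = ⨅-glb IsIterate (b ν) λ where
          y (lift (zero   , y≈)) → trans (⊤-max _) (≈⇒≥ y≈)
          y (lift (sucℕ k , y≈)) → trans (proj₁ b-image-glb (it k) (lift (k , Eq.refl))) (≈⇒≥ y≈)

        ν≤bν : ν ≤ b ν
        ν≤bν = proj₂ b-image-glb ν λ where
          y (lift (n , y≈)) → trans (ν≤it (sucℕ n)) (b-mono (≈⇒≥ y≈))

      -- Hence a greatest fixed point lies above every common lower bound of
      -- the iterates (it is above ν, their meet).
      below-gfp : ∀ g → IsGreatestFixedPoint C b g → ∀ z → (∀ n → z ≤ it n) → z ≤ g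
      below-gfp g (_ , g-greatest) z z≤it =
        trans (⨅-glb IsIterate z λ y (lift (n , y≈)) → trans (z≤it n) (≈⇒≥ y≈))
              (g-greatest ν ν-fixed)

      compatible-pre-Ω : ∀ a → Monotone C a → Compatible C a b → _⊆_ C (Ω C b) (Pre C a)
      compatible-pre-Ω a a-mono a-compat y (inj₁ (n , y≈)) =
        lift (trans (a-mono (reflexive y≈)) (trans (compatible-pre-it a a-compat n) (≈⇒≥ y≈)))
      compatible-pre-Ω a a-mono a-compat y (inj₂ y-gfp@(by≈y , _)) =
        lift (below-gfp y y-gfp (a y) λ n →
                trans (a-mono (fixed≤it y by≈y n)) (compatible-pre-it a a-compat n))

      -- ω_b is compatible: b(ω_b x) is the meet of the b-images of the points
      -- of Ω_b above x, each of which lies in Ω_b above b x.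
      ω-compatible : Compatible C (ω C b) b
      ω-compatible x = proj₂ (b-cocont (Above (Ω C b) x) (Above-Ω-codirected x)) (ω C b (b x))
        λ y (Ωy , x≤y) → ⨅-lower (Above (Ω C b) (b x)) (b y) (b-preserves-Ω y Ωy , b-mono x≤y)

theorem8p2 : {c ℓ₁ ℓ₂ : Level} (C : CompleteLattice c ℓ₁ ℓ₂)
    (b : CompleteLattice.Carrier C → CompleteLattice.Carrier C)
    → Monotone C b → ScottCocontinuous C b
    → (Monotone C (ω C b) × Compatible C (ω C b) b)
      × (∀ a → Monotone C a → Compatible C a b → _⊑ᶠ_ C a (ω C b))
      × (∀ a → IsUpClosure C a → (_⊑ᶠ_ C a (ω C b) ⇔ _⊆_ C (Ω C b) (Pre C a)))
theorem8p2 C b b-mono b-cocont =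
    (closure-mono (Ω C b) , ω-compatible)
  , (λ a a-mono a-compat →
       Equivalence.from (below-closure⇔ (Ω C b) a a-mono) (compatible-pre-Ω a a-mono a-compat))
  , (λ a (a-mono , _) → below-closure⇔ (Ω C b) a a-mono)
  where
  open LatticeFacts C
  open Iterates b b-mono
  open Cocontinuous b-cocont
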